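{- Let $M$ be a simple binary matroid having some induced minor isomorphic to a circuit $U_{m-1,m}$, and let $n$ be the largest $m$ such that some induced minor of $M$ is isomorphic to $U_{m-1,m}$. Then $M$ has an induced restriction isomorphic to $U_{n-1,n}$ (an $n$-element circuit).
   Context: All matroids are finite and simple; every contraction is immediately followed by simplification. An induced restriction of $M$ is $M|F$ for a flat $F$ of $M$; an induced minor of $M$ is any matroid obtained from $M$ by a sequence of contractions (followed by simplification) and restrictions to flats. -}

module Defs where

open import Data.Nat using (ℕ; zero; suc; _≤_; _∸_)
open import Data.Bool using (Bool; true; false; _xor_; if_then_else_)
open import Data.Fin using (Fin; zero; suc)
open import Data.Fin.Subset using (Subset; _∈_; _∉_; _⊆_; _∪_; ⁅_⁆; ∣_∣) renaming (⊥ to ∅)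
open import Data.Vec using (Vec; []; _∷_; replicate; zipWith)
open import Data.Product using (Σ; ∃; _×_; _,_)
open import Function using (_∘_; _⇔_)
open import Function.Definitions using (Injective)
open import Relation.Binary.PropositionalEquality using (_≡_; _≢_)
open import Relation.Nullary using (¬_)

-- Linear algebra over GF(2): vectors in GF(2)^r are  Vec Bool r.

zeroV : ∀ {r} → Vec Bool r
zeroV = replicate _ false

_⊕_ : ∀ {r} → Vec Bool r → Vec Bool r → Vec Bool r
_⊕_ = zipWith _xor_

sumSub : ∀ {r k} → (Fin k → Vec Bool r) → Subset k → Vec Bool r
sumSub {k = zero}  w []      = zeroV
sumSub {k = suc k} w (b ∷ T) =
  (if b then w zero else zeroV) ⊕ sumSub (w ∘ suc) T

-- Simple binary matroids, given by a GF(2)-representation: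
-- ground set Fin m, element i represented by the vector  vec i ∈ GF(2)^r.

record SimpleBinaryMatroid : Set where
  field
    r       : ℕ
    m       : ℕ
    vec     : Fin m → Vec Bool r
    noLoops : ∀ i → vec i ≢ zeroV
    noParallel : Injective _≡_ _≡_ vec

module _ (M : SimpleBinaryMatroid) where
  open SimpleBinaryMatroid M

  InSpan : Subset m → Vec Bool r → Set
  InSpan C w = Σ (Subset m) λ T → T ⊆ C × sumSub vec T ≡ w

  -- Minors of M are described by a pair (C , X) of subsets of E(M):
  -- the matroid  (M / C) | X ,  whose element x ∈ X is represented by
  -- vec x modulo span(vec[C]).  Independence in M / C of a family w
  -- (indexed by S ⊆ Fin k): no nonempty subfamily sums into span(C).
  IndepMod : ∀ {k} → Subset m → (Fin k → Vec Bool r) → Subset k → Set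
  IndepMod C w S = ∀ T → T ⊆ S → InSpan C (sumSub w T) → T ≡ ∅

  IsFlat : Subset m → Subset m → Subset m → Set
  IsFlat C X F = F ⊆ X × (∀ x → x ∈ X → InSpan (C ∪ F) (vec x) → x ∈ F)

  data Step : (Subset m × Subset m) → (Subset m × Subset m) → Set where
    restrict : ∀ {C X F} → IsFlat C X F → Step (C , X) (C , F)
    -- contraction of an element x ∈ X followed by simplification:
    -- X' ⊆ X - {x} is a set of representatives, exactly one from each
    -- parallel class of non-loops of  (M / (C ∪ {x})) | (X - {x}).
    contract : ∀ {C X X'} (x : Fin m) → x ∈ X →
      let C' = C ∪ ⁅ x ⁆ in
      X' ⊆ X → x ∉ X' →
      (∀ y → y ∈ X' → ¬ InSpan C' (vec y)) →
      (∀ y z → y ∈ X' → z ∈ X' → y ≢ z → ¬ InSpan C' (vec y ⊕ vec z)) →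
      (∀ y → y ∈ X → y ≢ x → ¬ InSpan C' (vec y) →
         Σ (Fin m) λ z → z ∈ X' × InSpan C' (vec y ⊕ vec z)) →
      Step (C , X) (C' , X')

  -- Reflexive-transitive closure, starting from M itself = (∅ , E(M)).
  data Reachable : (Subset m × Subset m) → Set where
    start : Reachable (∅ , Data.Fin.Subset.⊤)
    step  : ∀ {s t} → Reachable s → Step s t → Reachable t

  -- The matroid (M / C) | X is isomorphic to the uniform matroid U_{k,n}
  -- (ground set Fin n, S independent iff |S| ≤ k): a bijection f from Fin n
  -- onto X that preserves independence in both directions.
  IsoUniform : ℕ → ℕ → Subset m → Subset m → Set
  IsoUniform k n C X =
    Σ (Fin n → Fin m) λ f →
      Injective _≡_ _≡_ f ×
      (∀ j → f j ∈ X) ×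
      (∀ x → x ∈ X → ∃ λ j → f j ≡ x) ×
      (∀ (S : Subset n) → (∣ S ∣ ≤ k) ⇔ IndepMod C (vec ∘ f) S)

  HasCircuitInducedMinor : ℕ → Set
  HasCircuitInducedMinor n =
    1 ≤ n × Σ (Subset m × Subset m) λ { (C , X) →
      Reachable (C , X) × IsoUniform (n ∸ 1) n C X }

  HasCircuitInducedRestriction : ℕ → Set
  HasCircuitInducedRestriction n =
    Σ (Subset m) λ F → IsFlat ∅ Data.Fin.Subset.⊤ F × IsoUniform (n ∸ 1) n ∅ F

{-# OPTIONS --safe #-}
-- Write W for the span of the contracted set C, so that the induced minor
-- (M / C) | X is X read modulo W.  Every reachable minor is simple, and every
-- element of M lying in W + span X is in W or congruent modulo W to an element
-- of X.  An induced U_{n-1,n}-minor is therefore an induced circuit modulo W: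
-- a family f whose only nonempty dependency modulo W is the whole family, and
-- such that every element of M in W + span f is in W or congruent to some f_j.
--
-- Removing one generator e from W (with e not in the remaining span W₀) keeps
-- an induced circuit of at least the same length.  If the sum of f lies in W₀,
-- f itself works.  Otherwise the sum is congruent to e modulo W₀; then either
-- some element a of M is congruent to f_i + e, and replacing f_i by a makes the sum
-- vanish modulo W₀, or there is no such a and adjoining e to f gives an induced
-- circuit modulo W₀ that is one longer.  Iterating down to W = 0 gives an
-- induced circuit of M itself, i.e. a circuit restriction of M to a flat, of
-- length n' ≥ n (simplicity gives n ≥ 3, which makes f injective), and the
-- maximality of n forces n' = n.

module Submission where

open import Defs
open import Data.Nat using (ℕ; zero; suc; _+_; _≤_; _∸_; z≤n; s≤s)
open import Data.Nat.Properties using (≤-refl; ≤-trans; ≤-antisym; n≤1+n; 1+n≰n; <⇒≤pred; ≤∧≢⇒<)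
open import Data.Bool using (Bool; true; false; _xor_; if_then_else_)
import Data.Bool as Bool
open import Data.Bool.Properties
  using (xor-assoc; xor-comm; xor-identityˡ; xor-identityʳ; xor-same; T-≡)
open import Data.Fin using (Fin; zero; suc; punchIn; punchOut)
open import Data.Fin.Properties
  using (any?; 0≢1+n; suc-injective; punchInᵢ≢i; punchIn-injective; punchIn-punchOut)
  renaming (_≟_ to _≟ᶠ_)
open import Data.Fin.Subset using (Subset; inside; outside; _∈_; _⊆_; _∪_; ⁅_⁆; ⊤; ∣_∣) renaming (⊥ to ∅)
open import Data.Fin.Subset.Properties
  using (∈⊤; ⊆⊤; ∉⊥; ⊥⊆; ⊆-antisym; drop-∷-⊆; out⊆; in⊆in; x∈⁅x⁆; x∈⁅y⁆⇒x≡y; p⊆p∪q; q⊆p∪q; x∈p∪q⁻;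
         ∣p∣≤n; ∣⊤∣≡n; ∣p∣≡n⇒p≡⊤; anySubset?)
open import Data.Vec using (Vec; []; _∷_; here; there; tabulate)
open import Data.Vec.Properties
  using (zipWith-assoc; zipWith-comm; zipWith-identityˡ; zipWith-identityʳ; ≡-dec; lookup∘tabulate;
         []=⇒lookup; lookup⇒[]=)
import Data.Vec.Functional as Vector
open import Data.Vec.Functional.Properties using (updateAt-updates; updateAt-minimal)
open import Data.Product using (∃; _×_; _,_; proj₁; proj₂)
import Data.Product as Product
open import Data.Sum using (_⊎_; inj₁; inj₂; [_,_]′)
import Data.Sum as Sum
open import Data.Empty using (⊥-elim)
open import Function using (_∘_; mk⇔; id; const; case_of_)
open import Function.Bundles using (Equivalence)
open import Function.Definitions using (Injective)
open import Relation.Binary.Definitions using (DecidableEquality)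
open import Relation.Binary.PropositionalEquality
  using (_≡_; _≢_; refl; sym; trans; cong; cong₂; subst; module ≡-Reasoning)
open import Relation.Nullary using (¬_; Dec; yes; no; contradiction)
open import Relation.Nullary.Decidable
  using (⌊_⌋; _×-dec_; _⊎-dec_; ¬?; map′; toWitness; fromWitness; decidable-stable)
open import Relation.Unary using (_≐_)
open import Relation.Unary.Properties using (≐-trans)

module _ {r : ℕ} where

  ⊕-assoc : (x y z : Vec Bool r) → (x ⊕ y) ⊕ z ≡ x ⊕ (y ⊕ z)
  ⊕-assoc = zipWith-assoc xor-assoc

  ⊕-comm : (x y : Vec Bool r) → x ⊕ y ≡ y ⊕ x
  ⊕-comm = zipWith-comm xor-comm

  ⊕-identityˡ : (x : Vec Bool r) → zeroV ⊕ x ≡ x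
  ⊕-identityˡ = zipWith-identityˡ xor-identityˡ

  ⊕-identityʳ : (x : Vec Bool r) → x ⊕ zeroV ≡ x
  ⊕-identityʳ = zipWith-identityʳ xor-identityʳ

⊕-self : ∀ {r} (x : Vec Bool r) → x ⊕ x ≡ zeroV
⊕-self []      = refl
⊕-self (a ∷ x) = cong₂ _∷_ (xor-same a) (⊕-self x)

module _ {r : ℕ} where
  open ≡-Reasoning

  ⊕-cancelˡ : (x y : Vec Bool r) → x ⊕ (x ⊕ y) ≡ y
  ⊕-cancelˡ x y = begin
    x ⊕ (x ⊕ y)  ≡⟨ ⊕-assoc x x y ⟨
    (x ⊕ x) ⊕ y  ≡⟨ cong (_⊕ y) (⊕-self x) ⟩
    zeroV ⊕ y    ≡⟨ ⊕-identityˡ y ⟩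
    y            ∎

  ⊕-cancelʳ : (x y : Vec Bool r) → (x ⊕ y) ⊕ y ≡ x
  ⊕-cancelʳ x y = begin
    (x ⊕ y) ⊕ y  ≡⟨ ⊕-assoc x y y ⟩
    x ⊕ (y ⊕ y)  ≡⟨ cong (x ⊕_) (⊕-self y) ⟩
    x ⊕ zeroV    ≡⟨ ⊕-identityʳ x ⟩
    x            ∎

  ⊕-chain : (x y z : Vec Bool r) → (x ⊕ y) ⊕ (y ⊕ z) ≡ x ⊕ z
  ⊕-chain x y z = trans (⊕-assoc x y (y ⊕ z)) (cong (x ⊕_) (⊕-cancelˡ y z))

  ⊕-interchange : (w x y z : Vec Bool r) → (w ⊕ x) ⊕ (y ⊕ z) ≡ (w ⊕ y) ⊕ (x ⊕ z)
  ⊕-interchange w x y z = begin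
    (w ⊕ x) ⊕ (y ⊕ z)  ≡⟨ ⊕-assoc w x (y ⊕ z) ⟩
    w ⊕ (x ⊕ (y ⊕ z))  ≡⟨ cong (w ⊕_) (⊕-assoc x y z) ⟨
    w ⊕ ((x ⊕ y) ⊕ z)  ≡⟨ cong (λ t → w ⊕ (t ⊕ z)) (⊕-comm x y) ⟩
    w ⊕ ((y ⊕ x) ⊕ z)  ≡⟨ cong (w ⊕_) (⊕-assoc y x z) ⟩
    w ⊕ (y ⊕ (x ⊕ z))  ≡⟨ ⊕-assoc w y (x ⊕ z) ⟨
    (w ⊕ y) ⊕ (x ⊕ z)  ∎

  ⊕≡zero⇒≡ : (x y : Vec Bool r) → x ⊕ y ≡ zeroV → x ≡ y
  ⊕≡zero⇒≡ x y x⊕y≡0 = begin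
    x                ≡⟨ ⊕-cancelʳ x y ⟨
    (x ⊕ y) ⊕ y      ≡⟨ cong (_⊕ y) x⊕y≡0 ⟩
    zeroV ⊕ y        ≡⟨ ⊕-identityˡ y ⟩
    y                ∎

_≟ˢ_ : ∀ {n} → DecidableEquality (Subset n)
_≟ˢ_ = ≡-dec Bool._≟_

∪-lub : ∀ {n} {p q s : Subset n} → p ⊆ s → q ⊆ s → p ∪ q ⊆ s
∪-lub {p = p} {q} p⊆s q⊆s x∈p∪q = [ p⊆s , q⊆s ]′ (x∈p∪q⁻ p q x∈p∪q)

x∈p⇒⁅x⁆⊆p : ∀ {n} {x : Fin n} {p : Subset n} → x ∈ p → ⁅ x ⁆ ⊆ p
x∈p⇒⁅x⁆⊆p {x = x} {p} x∈p y∈⁅x⁆ = subst (_∈ p) (sym (x∈⁅y⁆⇒x≡y x y∈⁅x⁆)) x∈p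

⊕-⊆ : ∀ {n} {p q s : Subset n} → p ⊆ s → q ⊆ s → p ⊕ q ⊆ s
⊕-⊆ {p = inside  ∷ _} {outside ∷ _} p⊆s q⊆s here = p⊆s here
⊕-⊆ {p = outside ∷ _} {inside  ∷ _} p⊆s q⊆s here = q⊆s here
⊕-⊆ {p = _ ∷ _} {_ ∷ _} {_ ∷ _} p⊆s q⊆s (there x∈) = there (⊕-⊆ (drop-∷-⊆ p⊆s) (drop-∷-⊆ q⊆s) x∈)

⁅⁆-injective : ∀ {n} {x y : Fin n} → ⁅ x ⁆ ≡ ⁅ y ⁆ → x ≡ y
⁅⁆-injective {x = x} {y} eq = x∈⁅y⁆⇒x≡y y (subst (x ∈_) eq (x∈⁅x⁆ x))

⊤⊈⁅x⁆∪⁅y⁆ : ∀ {k} (x y : Fin (3 + k)) → ¬ (⊤ ⊆ ⁅ x ⁆ ∪ ⁅ y ⁆)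
⊤⊈⁅x⁆∪⁅y⁆ x y ⊤⊆ with third
  where
  third : ∃ λ z → z ≢ x × z ≢ y
  third with x ≟ᶠ y
  ... | yes refl = punchIn x zero , punchInᵢ≢i x zero , punchInᵢ≢i x zero
  ... | no x≢y   = punchIn x z′ , punchInᵢ≢i x z′ , z≢y
    where
    y′ = punchOut x≢y
    z′ = punchIn y′ zero
    z≢y : punchIn x z′ ≢ y
    z≢y z≡y = punchInᵢ≢i y′ zero (punchIn-injective x z′ y′ (trans z≡y (sym (punchIn-punchOut x≢y))))
... | z , z≢x , z≢y =
  [ z≢x ∘ x∈⁅y⁆⇒x≡y x , z≢y ∘ x∈⁅y⁆⇒x≡y y ]′ (x∈p∪q⁻ ⁅ x ⁆ ⁅ y ⁆ (⊤⊆ ∈⊤))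

p≢⊤⇒∣p∣≤n∸1 : ∀ {n} {p : Subset n} → p ≢ ⊤ → ∣ p ∣ ≤ n ∸ 1
p≢⊤⇒∣p∣≤n∸1 {zero}  {[]} []≢⊤ = contradiction refl []≢⊤
p≢⊤⇒∣p∣≤n∸1 {suc n} {p}  p≢⊤  = <⇒≤pred (≤∧≢⇒< (∣p∣≤n p) (p≢⊤ ∘ ∣p∣≡n⇒p≡⊤))

∣⊤∣≰n∸1 : ∀ {n} → 1 ≤ n → ¬ (∣ ⊤ {n} ∣ ≤ n ∸ 1)
∣⊤∣≰n∸1 {suc n} _ = 1+n≰n ∘ subst (_≤ n) (∣⊤∣≡n (suc n))

image : ∀ {n m} → (Fin n → Fin m) → Subset m
image f = tabulate λ x → ⌊ any? (λ j → f j ≟ᶠ x) ⌋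

∈-image⁺ : ∀ {n m} (f : Fin n → Fin m) j → f j ∈ image f
∈-image⁺ f j = lookup⇒[]= (f j) (image f)
  (trans (lookup∘tabulate _ (f j)) (Equivalence.to T-≡ (fromWitness (j , refl))))

∈-image⁻ : ∀ {n m} (f : Fin n → Fin m) x → x ∈ image f → ∃ λ j → f j ≡ x
∈-image⁻ f x x∈ = toWitness {a? = any? λ j → f j ≟ᶠ x}
  (Equivalence.from T-≡ (trans (sym (lookup∘tabulate _ x)) ([]=⇒lookup x∈)))

sumSub-closed : ∀ {r k} (P : Vec Bool r → Set) → P zeroV → (∀ {u v} → P u → P v → P (u ⊕ v)) →
  (w : Fin k → Vec Bool r) (T : Subset k) → (∀ j → j ∈ T → P (w j)) → P (sumSub w T)
sumSub-closed P p0 p⊕ w []            _   = p0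
sumSub-closed P p0 p⊕ w (outside ∷ T) T⊆P =
  p⊕ p0 (sumSub-closed P p0 p⊕ (w ∘ suc) T λ j → T⊆P (suc j) ∘ there)
sumSub-closed P p0 p⊕ w (inside ∷ T)  T⊆P =
  p⊕ (T⊆P zero here) (sumSub-closed P p0 p⊕ (w ∘ suc) T λ j → T⊆P (suc j) ∘ there)

sumSub-vanishing : ∀ {r k} (w : Fin k → Vec Bool r) T →
  (∀ j → j ∈ T → w j ≡ zeroV) → sumSub w T ≡ zeroV
sumSub-vanishing = sumSub-closed (_≡ zeroV) refl λ { refl refl → ⊕-self zeroV }

sumSub-∅ : ∀ {r k} (w : Fin k → Vec Bool r) → sumSub w ∅ ≡ zeroV
sumSub-∅ w = sumSub-vanishing w ∅ λ _ j∈∅ → contradiction j∈∅ ∉⊥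

sumSub-⁅⁆ : ∀ {r k} (w : Fin k → Vec Bool r) i → sumSub w ⁅ i ⁆ ≡ w i
sumSub-⁅⁆ w zero    = trans (cong (w zero ⊕_) (sumSub-∅ (w ∘ suc))) (⊕-identityʳ (w zero))
sumSub-⁅⁆ w (suc i) = trans (⊕-identityˡ _) (sumSub-⁅⁆ (w ∘ suc) i)

sumSub-supported : ∀ {r k} (w : Fin k → Vec Bool r) i →
  (∀ j → j ≢ i → w j ≡ zeroV) → sumSub w ⊤ ≡ w i
sumSub-supported w zero w≡0 =
  trans (cong (w zero ⊕_) (sumSub-vanishing (w ∘ suc) ⊤ λ j _ → w≡0 (suc j) (0≢1+n ∘ sym)))
    (⊕-identityʳ (w zero))
sumSub-supported w (suc i) w≡0 =
  trans (cong (_⊕ sumSub (w ∘ suc) ⊤) (w≡0 zero 0≢1+n))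
    (trans (⊕-identityˡ _) (sumSub-supported (w ∘ suc) i λ j j≢i → w≡0 (suc j) (j≢i ∘ suc-injective)))

sumSub-⊕-family : ∀ {r k} (u v : Fin k → Vec Bool r) T →
  sumSub (λ j → u j ⊕ v j) T ≡ sumSub u T ⊕ sumSub v T
sumSub-⊕-family u v []      = sym (⊕-self zeroV)
sumSub-⊕-family u v (b ∷ T) =
  trans (cong₂ _⊕_ (if-⊕ b) (sumSub-⊕-family (u ∘ suc) (v ∘ suc) T)) (⊕-interchange _ _ _ _)
  where
  if-⊕ : ∀ b → (if b then u zero ⊕ v zero else zeroV) ≡
               (if b then u zero else zeroV) ⊕ (if b then v zero else zeroV)
  if-⊕ true  = refl
  if-⊕ false = sym (⊕-self zeroV)

sumSub-⊕-subset : ∀ {r k} (w : Fin k → Vec Bool r) S T → sumSub w (S ⊕ T) ≡ sumSub w S ⊕ sumSub w T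
sumSub-⊕-subset w []      []      = sym (⊕-self zeroV)
sumSub-⊕-subset w (a ∷ S) (b ∷ T) =
  trans (cong₂ _⊕_ (if-xor a b) (sumSub-⊕-subset (w ∘ suc) S T)) (⊕-interchange _ _ _ _)
  where
  if-xor : ∀ a b → (if a xor b then w zero else zeroV) ≡
                   (if a then w zero else zeroV) ⊕ (if b then w zero else zeroV)
  if-xor false false = sym (⊕-self zeroV)
  if-xor false true  = sym (⊕-identityˡ (w zero))
  if-xor true  false = sym (⊕-identityʳ (w zero))
  if-xor true  true  = sym (⊕-self (w zero))

-- Subspaces and spans

record IsSubspace {r} (W : Vec Bool r → Set) : Set where
  field
    zero∈    : W zeroV
    ⊕-closed : ∀ {u v} → W u → W v → W (u ⊕ v)
    dec      : ∀ v → Dec (W v)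

  -- ≈ is congruence modulo W: u ≈ v stands for W (u ⊕ v).

  ≈-refl : ∀ {u} → W (u ⊕ u)
  ≈-refl {u} = subst W (sym (⊕-self u)) zero∈

  ≈-sym : ∀ {u v} → W (u ⊕ v) → W (v ⊕ u)
  ≈-sym {u} {v} = subst W (⊕-comm u v)

  ≈-trans : ∀ {u v w} → W (u ⊕ v) → W (v ⊕ w) → W (u ⊕ w)
  ≈-trans {u} {v} {w} u≈v v≈w = subst W (⊕-chain u v w) (⊕-closed u≈v v≈w)

  ∈-resp-≈ : ∀ {u v} → W u → W (u ⊕ v) → W v
  ∈-resp-≈ {u} {v} u∈W u≈v = subst W (⊕-cancelˡ u v) (⊕-closed u∈W u≈v)

  sum-closed : ∀ {k} (w : Fin k → Vec Bool r) T → (∀ j → W (w j)) → W (sumSub w T)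
  sum-closed w T w∈W = sumSub-closed W zero∈ ⊕-closed w T λ j _ → w∈W j

_+⟨_⟩ : ∀ {r} → (Vec Bool r → Set) → Vec Bool r → Vec Bool r → Set
(W +⟨ e ⟩) v = W v ⊎ W (v ⊕ e)

module _ {r} {W : Vec Bool r → Set} (W-sub : IsSubspace W) (e : Vec Bool r) where
  open IsSubspace W-sub

  +⟨⟩-isSubspace : IsSubspace (W +⟨ e ⟩)
  +⟨⟩-isSubspace = record
    { zero∈    = inj₁ zero∈
    ; ⊕-closed = closed
    ; dec      = λ v → dec v ⊎-dec dec (v ⊕ e)
    }
    where
    mixed : ∀ {u v} → W u → W (v ⊕ e) → W ((u ⊕ v) ⊕ e)
    mixed {u} {v} u∈W v≈e = subst W (sym (⊕-assoc u v e)) (⊕-closed u∈W v≈e)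
    closed : ∀ {u v} → (W +⟨ e ⟩) u → (W +⟨ e ⟩) v → (W +⟨ e ⟩) (u ⊕ v)
    closed         (inj₁ u∈W) (inj₁ v∈W) = inj₁ (⊕-closed u∈W v∈W)
    closed         (inj₁ u∈W) (inj₂ v≈e) = inj₂ (mixed u∈W v≈e)
    closed {u} {v} (inj₂ u≈e) (inj₁ v∈W) = inj₂ (subst (λ x → W (x ⊕ e)) (⊕-comm v u) (mixed v∈W u≈e))
    closed         (inj₂ u≈e) (inj₂ v≈e) = inj₁ (≈-trans u≈e (≈-sym v≈e))

  +⟨⟩-absorb : W e → (W +⟨ e ⟩) ≐ W
  +⟨⟩-absorb e∈W = [ id , ∈-resp-≈ e∈W ∘ ≈-sym ]′ , inj₁

Span : ∀ {r k} → (Fin k → Vec Bool r) → Subset k → Vec Bool r → Set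
Span {k = k} w C v = ∃ λ (T : Subset k) → T ⊆ C × sumSub w T ≡ v

module _ {r k} (w : Fin k → Vec Bool r) where

  Span-zero : ∀ {C} → Span w C zeroV
  Span-zero = ∅ , ⊥⊆ , sumSub-∅ w

  Span-⊕ : ∀ {C u v} → Span w C u → Span w C v → Span w C (u ⊕ v)
  Span-⊕ (S , S⊆C , refl) (T , T⊆C , refl) = S ⊕ T , ⊕-⊆ S⊆C T⊆C , sumSub-⊕-subset w S T

  Span-gen : ∀ {C} c → c ∈ C → Span w C (w c)
  Span-gen c c∈C = ⁅ c ⁆ , x∈p⇒⁅x⁆⊆p c∈C , sumSub-⁅⁆ w c

  Span-mono : ∀ {C D v} → C ⊆ D → Span w C v → Span w D v
  Span-mono C⊆D (T , T⊆C , σT≡v) = T , C⊆D ∘ T⊆C , σT≡v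

  Span-∅ : Span w ∅ ≐ (_≡ zeroV)
  Span-∅ = (λ { (T , T⊆∅ , refl) → trans (cong (sumSub w) (⊆-antisym T⊆∅ ⊥⊆)) (sumSub-∅ w) })
         , λ { refl → Span-zero }

module _ {r k} {w : Fin (suc k) → Vec Bool r} {C : Subset k} where

  Span-outside : Span w (outside ∷ C) ≐ Span (w ∘ suc) C
  Span-outside = to , λ (T , T⊆C , σT≡v) → outside ∷ T , out⊆ T⊆C , trans (⊕-identityˡ _) σT≡v
    where
    to : ∀ {v} → Span w (outside ∷ C) v → Span (w ∘ suc) C v
    to (outside ∷ T , T⊆ , σT≡v) = T , drop-∷-⊆ T⊆ , trans (sym (⊕-identityˡ _)) σT≡v
    to (inside  ∷ T , T⊆ , _)    = case T⊆ here of λ ()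

  Span-inside : Span w (inside ∷ C) ≐ (Span (w ∘ suc) C +⟨ w zero ⟩)
  Span-inside = to , from
    where
    to : ∀ {v} → Span w (inside ∷ C) v → (Span (w ∘ suc) C +⟨ w zero ⟩) v
    to (outside ∷ T , T⊆ , σT≡v) = inj₁ (T , drop-∷-⊆ T⊆ , trans (sym (⊕-identityˡ _)) σT≡v)
    to {v} (inside ∷ T , T⊆ , σT≡v) = inj₂ (T , drop-∷-⊆ T⊆ , (begin
      sumSub (w ∘ suc) T                      ≡⟨ ⊕-cancelˡ (w zero) _ ⟨
      w zero ⊕ (w zero ⊕ sumSub (w ∘ suc) T)  ≡⟨ cong (w zero ⊕_) σT≡v ⟩
      w zero ⊕ v                              ≡⟨ ⊕-comm (w zero) v ⟩
      v ⊕ w zero                              ∎))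
      where open ≡-Reasoning
    from : ∀ {v} → (Span (w ∘ suc) C +⟨ w zero ⟩) v → Span w (inside ∷ C) v
    from (inj₁ (T , T⊆C , σT≡v)) = outside ∷ T , out⊆ T⊆C , trans (⊕-identityˡ _) σT≡v
    from {v} (inj₂ (T , T⊆C , σT≡v+w₀)) = inside ∷ T , in⊆in T⊆C , (begin
      w zero ⊕ sumSub (w ∘ suc) T  ≡⟨ cong (w zero ⊕_) σT≡v+w₀ ⟩
      w zero ⊕ (v ⊕ w zero)        ≡⟨ cong (w zero ⊕_) (⊕-comm v (w zero)) ⟩
      w zero ⊕ (w zero ⊕ v)        ≡⟨ ⊕-cancelˡ (w zero) v ⟩
      v                            ∎)
      where open ≡-Reasoning

Span? : ∀ {r k} (w : Fin k → Vec Bool r) C v → Dec (Span w C v)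
Span? w []            v = map′ (proj₂ (Span-∅ w)) (proj₁ (Span-∅ w)) (≡-dec Bool._≟_ v zeroV)
Span? w (outside ∷ C) v = map′ (proj₂ Span-outside) (proj₁ Span-outside) (Span? (w ∘ suc) C v)
Span? w (inside  ∷ C) v = map′ (proj₂ Span-inside) (proj₁ Span-inside)
  (Span? (w ∘ suc) C v ⊎-dec Span? (w ∘ suc) C (v ⊕ w zero))

Span-isSubspace : ∀ {r k} (w : Fin k → Vec Bool r) C → IsSubspace (Span w C)
Span-isSubspace w C = record { zero∈ = Span-zero w ; ⊕-closed = Span-⊕ w ; dec = Span? w C }

-- Induced circuits modulo a subspace

module _ (M : SimpleBinaryMatroid) where
  open SimpleBinaryMatroid M

  σ : ∀ {k} → (Fin k → Fin m) → Subset k → Vec Bool r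
  σ f = sumSub (vec ∘ f)

  σ-⊕⁅⁆ : ∀ {k} (f : Fin k → Fin m) T j → σ f (T ⊕ ⁅ j ⁆) ≡ σ f T ⊕ vec (f j)
  σ-⊕⁅⁆ f T j = trans (sumSub-⊕-subset (vec ∘ f) T ⁅ j ⁆) (cong (σ f T ⊕_) (sumSub-⁅⁆ (vec ∘ f) j))

  σ-updateAt : ∀ {k} (f : Fin k → Fin m) i a →
    σ (Vector.updateAt f i (const a)) ⊤ ⊕ σ f ⊤ ≡ vec a ⊕ vec (f i)
  σ-updateAt f i a = begin
    σ f′ ⊤ ⊕ σ f ⊤                              ≡⟨ sumSub-⊕-family (vec ∘ f′) (vec ∘ f) ⊤ ⟨
    sumSub (λ j → vec (f′ j) ⊕ vec (f j)) ⊤     ≡⟨ sumSub-supported _ i unchanged ⟩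
    vec (f′ i) ⊕ vec (f i)                      ≡⟨ cong (λ x → vec x ⊕ vec (f i)) (updateAt-updates i f) ⟩
    vec a ⊕ vec (f i)                           ∎
    where
    open ≡-Reasoning
    f′ = Vector.updateAt f i (const a)
    unchanged : ∀ j → j ≢ i → vec (f′ j) ⊕ vec (f j) ≡ zeroV
    unchanged j j≢i rewrite updateAt-minimal j i {const a} f j≢i = ⊕-self (vec (f j))

  SpanMod : (Vec Bool r → Set) → ∀ {k} → (Fin k → Fin m) → Vec Bool r → Set
  SpanMod W {k} f v = ∃ λ (T : Subset k) → W (v ⊕ σ f T)

  record InducedCircuit (W : Vec Bool r → Set) (k : ℕ) (f : Fin k → Fin m) : Set where
    field
      minimal   : ∀ T → W (σ f T) → T ≡ ∅ ⊎ T ≡ ⊤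
      dependent : W (σ f ⊤)
      closed    : ∀ y → SpanMod W f (vec y) → W (vec y) ⊎ ∃ λ j → W (vec y ⊕ vec (f j))

  InducedCircuit≥ : (Vec Bool r → Set) → ℕ → Set
  InducedCircuit≥ W k = ∃ λ k′ → k ≤ k′ × ∃ λ (f : Fin k′ → Fin m) → InducedCircuit W k′ f

  InducedCircuit-resp : ∀ {W W′ k f} → W ≐ W′ → InducedCircuit W k f → InducedCircuit W′ k f
  InducedCircuit-resp (W⊆W′ , W′⊆W) c = record
    { minimal   = λ T → minimal T ∘ W′⊆W
    ; dependent = W⊆W′ dependent
    ; closed    = λ y (T , y≈σT) → Sum.map W⊆W′ (Product.map₂ W⊆W′) (closed y (T , W′⊆W y≈σT))
    }
    where open InducedCircuit c

  InducedCircuit-congr : ∀ {W k f f′} → IsSubspace W → (∀ j → W (vec (f′ j) ⊕ vec (f j))) →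
    InducedCircuit W k f → InducedCircuit W k f′
  InducedCircuit-congr {W} {k} {f} {f′} W-sub f′≈f c = record
    { minimal   = λ T σ′T∈W → minimal T (∈-resp-≈ σ′T∈W (σ′≈σ T))
    ; dependent = ∈-resp-≈ dependent (≈-sym (σ′≈σ ⊤))
    ; closed    = λ y (T , y≈σ′T) → Sum.map₂ (Product.map₂ (λ y≈fj → ≈-trans y≈fj (≈-sym (f′≈f _))))
                                             (closed y (T , ≈-trans y≈σ′T (σ′≈σ T)))
    }
    where
    open IsSubspace W-sub
    open InducedCircuit c
    σ′≈σ : ∀ T → W (σ f′ T ⊕ σ f T)
    σ′≈σ T = subst W (sumSub-⊕-family (vec ∘ f′) (vec ∘ f) T) (sum-closed _ T f′≈f)

  module Uncontract {W : Vec Bool r → Set} (W-sub : IsSubspace W) (e : Fin m) (e∉W : ¬ W (vec e)) where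
    open IsSubspace W-sub

    W⁺ : Vec Bool r → Set
    W⁺ = W +⟨ vec e ⟩

    sum∈W⇒InducedCircuit : ∀ {k f} → W (σ f ⊤) → InducedCircuit W⁺ k f → InducedCircuit W k f
    sum∈W⇒InducedCircuit {k} {f} σ⊤∈W c = record
      { minimal   = λ T → minimal T ∘ inj₁
      ; dependent = σ⊤∈W
      ; closed    = closed′
      }
      where
      open InducedCircuit c
      σ≉e : ∀ T → ¬ W (σ f T ⊕ vec e)
      σ≉e T σT≈e with minimal T (inj₂ σT≈e)
      ... | inj₁ refl = e∉W (∈-resp-≈ (subst W (sym (sumSub-∅ (vec ∘ f))) zero∈) σT≈e)
      ... | inj₂ refl = e∉W (∈-resp-≈ σ⊤∈W σT≈e)
      closed′ : ∀ y → SpanMod W f (vec y) → W (vec y) ⊎ ∃ λ j → W (vec y ⊕ vec (f j))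
      closed′ y (T , y≈σT) with closed y (T , inj₁ y≈σT)
      ... | inj₁ (inj₁ y∈W)      = inj₁ y∈W
      ... | inj₂ (j , inj₁ y≈fj) = inj₂ (j , y≈fj)
      ... | inj₁ (inj₂ y≈e)      = contradiction (≈-trans (≈-sym y≈σT) y≈e) (σ≉e T)
      ... | inj₂ (j , inj₂ y≈fj+e) = contradiction σ[T⊕j]≈e (σ≉e (T ⊕ ⁅ j ⁆))
        where
        σ[T⊕j]≈e : W (σ f (T ⊕ ⁅ j ⁆) ⊕ vec e)
        σ[T⊕j]≈e = subst W (trans (sym (⊕-assoc _ _ _)) (cong (_⊕ vec e) (sym (σ-⊕⁅⁆ f T j))))
          (≈-trans (≈-sym y≈σT) (subst W (⊕-assoc _ _ _) y≈fj+e))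

    exchange : ∀ {k f} i a → W ((vec a ⊕ vec (f i)) ⊕ vec e) →
      InducedCircuit W⁺ k f → InducedCircuit W⁺ k (Vector.updateAt f i (const a))
    exchange {f = f} i a a≈fi+e = InducedCircuit-congr (+⟨⟩-isSubspace W-sub (vec e)) f′≈f
      where
      f′≈f : ∀ j → W⁺ (vec (Vector.updateAt f i (const a) j) ⊕ vec (f j))
      f′≈f j with j ≟ᶠ i
      ... | yes refl rewrite updateAt-updates j {const a} f = inj₂ a≈fi+e
      ... | no j≢i   rewrite updateAt-minimal j i {const a} f j≢i = inj₁ ≈-refl

    adjoin : ∀ {k f} → W (σ f ⊤ ⊕ vec e) → (∀ i a → ¬ W ((vec a ⊕ vec (f i)) ⊕ vec e)) →
      InducedCircuit W⁺ k f → InducedCircuit W (suc k) (e Vector.∷ f)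
    adjoin {k} {f} σ⊤≈e ∄a c = record
      { minimal   = minimal′
      ; dependent = ≈-sym σ⊤≈e
      ; closed    = closed′
      }
      where
      open InducedCircuit c
      minimal′ : ∀ T → W (σ (e Vector.∷ f) T) → T ≡ ∅ ⊎ T ≡ ⊤
      minimal′ (outside ∷ T) σT∈W with minimal T (inj₁ (subst W (⊕-identityˡ _) σT∈W))
      ... | inj₁ refl = inj₁ refl
      ... | inj₂ refl = contradiction (∈-resp-≈ (subst W (⊕-identityˡ _) σT∈W) σ⊤≈e) e∉W
      minimal′ (inside ∷ T) e+σT∈W with minimal T (inj₂ (≈-sym e+σT∈W))
      ... | inj₁ refl = contradiction (subst W e⊕σ∅≡e e+σT∈W) e∉W
        where e⊕σ∅≡e = trans (cong (vec e ⊕_) (sumSub-∅ (vec ∘ f))) (⊕-identityʳ (vec e))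
      ... | inj₂ refl = inj₂ refl
      spanMod⁺ : ∀ {v} → SpanMod W (e Vector.∷ f) v → SpanMod W⁺ f v
      spanMod⁺ {v} (outside ∷ T , v≈σT) = T , inj₁ (subst W (cong (v ⊕_) (⊕-identityˡ _)) v≈σT)
      spanMod⁺ {v} (inside  ∷ T , v≈e+σT) =
        T , inj₂ (subst W (trans (cong (v ⊕_) (⊕-comm _ _)) (sym (⊕-assoc _ _ _))) v≈e+σT)
      closed′ : ∀ y → SpanMod W (e Vector.∷ f) (vec y) →
                W (vec y) ⊎ ∃ λ j → W (vec y ⊕ vec ((e Vector.∷ f) j))
      closed′ y s with closed y (spanMod⁺ s)
      ... | inj₁ (inj₁ y∈W)        = inj₁ y∈W
      ... | inj₁ (inj₂ y≈e)        = inj₂ (zero , y≈e)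
      ... | inj₂ (j , inj₁ y≈fj)   = inj₂ (suc j , y≈fj)
      ... | inj₂ (j , inj₂ y≈fj+e) = contradiction y≈fj+e (∄a j y)

    uncontract : ∀ {k f} → InducedCircuit W⁺ k f → InducedCircuit≥ W k
    uncontract {k} {f} c with InducedCircuit.dependent c
    ... | inj₁ σ⊤∈W = k , ≤-refl , f , sum∈W⇒InducedCircuit σ⊤∈W c
    ... | inj₂ σ⊤≈e with any? (λ i → any? λ a → dec ((vec a ⊕ vec (f i)) ⊕ vec e))
    ...   | no ∄a = suc k , n≤1+n k , e Vector.∷ f , adjoin σ⊤≈e (λ i a → ∄a ∘ (i ,_) ∘ (a ,_)) c
    ...   | yes (i , a , a≈fi+e) =
      k , ≤-refl , _ , sum∈W⇒InducedCircuit σ′⊤∈W (exchange i a a≈fi+e c)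
      where
      σ′⊤∈W : W (σ (Vector.updateAt f i (const a)) ⊤)
      σ′⊤∈W = subst W (trans (cong (_⊕ σ f ⊤) (sym (σ-updateAt f i a))) (⊕-cancelʳ _ _))
                (≈-trans a≈fi+e (≈-sym σ⊤≈e))

  uncontractAll : ∀ {k n} (g : Fin k → Fin m) (C : Subset k) {f : Fin n → Fin m} →
    InducedCircuit (Span (vec ∘ g) C) n f → InducedCircuit≥ (_≡ zeroV) n
  uncontractAll g [] c = _ , ≤-refl , _ , InducedCircuit-resp (Span-∅ (vec ∘ g)) c
  uncontractAll g (outside ∷ C) c = uncontractAll (g ∘ suc) C (InducedCircuit-resp Span-outside c)
  uncontractAll g (inside ∷ C) c with Span? (vec ∘ g ∘ suc) C (vec (g zero))
  ... | yes g₀∈W = uncontractAll (g ∘ suc) C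
    (InducedCircuit-resp (≐-trans Span-inside (+⟨⟩-absorb (Span-isSubspace _ C) _ g₀∈W)) c)
  ... | no g₀∉W
    with Uncontract.uncontract (Span-isSubspace _ C) (g zero) g₀∉W (InducedCircuit-resp Span-inside c)
  ...   | k′ , n≤k′ , _ , c′ =
    Product.map₂ (Product.map₁ (≤-trans n≤k′)) (uncontractAll (g ∘ suc) C c′)

-- Reachable minors

  record IsInducedMinor (C X : Subset m) : Set where
    field
      nonLoop     : ∀ x → x ∈ X → ¬ InSpan M C (vec x)
      nonParallel : ∀ x y → x ∈ X → y ∈ X → x ≢ y → ¬ InSpan M C (vec x ⊕ vec y)
      closed      : ∀ y → InSpan M (C ∪ X) (vec y) →
                    InSpan M C (vec y) ⊎ ∃ λ z → z ∈ X × InSpan M C (vec y ⊕ vec z)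

  ⊤-isInducedMinor : IsInducedMinor ∅ ⊤
  ⊤-isInducedMinor = record
    { nonLoop     = λ x _ → noLoops x ∘ proj₁ (Span-∅ vec)
    ; nonParallel = λ x y _ _ x≢y → x≢y ∘ noParallel ∘ ⊕≡zero⇒≡ _ _ ∘ proj₁ (Span-∅ vec)
    ; closed      = λ y _ → inj₂ (y , ∈⊤ , proj₂ (Span-∅ vec) (⊕-self (vec y)))
    }

  Step-isInducedMinor : ∀ {C X C′ X′} → IsInducedMinor C X → Step M (C , X) (C′ , X′) →
    IsInducedMinor C′ X′
  Step-isInducedMinor {C} {X} minor (restrict {F = F} (F⊆X , F-flat)) = record
    { nonLoop     = λ x → nonLoop x ∘ F⊆X
    ; nonParallel = λ x y x∈F y∈F → nonParallel x y (F⊆X x∈F) (F⊆X y∈F)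
    ; closed      = closed′
    }
    where
    open IsInducedMinor minor
    module C∪F = IsSubspace (Span-isSubspace vec (C ∪ F))
    closed′ : ∀ y → InSpan M (C ∪ F) (vec y) →
              InSpan M C (vec y) ⊎ ∃ λ z → z ∈ F × InSpan M C (vec y ⊕ vec z)
    closed′ y y∈C∪F with closed y (Span-mono vec (∪-lub (p⊆p∪q X) (q⊆p∪q C X ∘ F⊆X)) y∈C∪F)
    ... | inj₁ y∈C = inj₁ y∈C
    ... | inj₂ (z , z∈X , y≈z) =
      inj₂ (z , F-flat z z∈X (C∪F.∈-resp-≈ y∈C∪F (Span-mono vec (p⊆p∪q F) y≈z)) , y≈z)
  Step-isInducedMinor {C} {X} minor
    (contract {X' = X′} x x∈X X′⊆X _ nonLoop′ nonParallel′ represented) = record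
    { nonLoop     = nonLoop′
    ; nonParallel = nonParallel′
    ; closed      = closed′
    }
    where
    open IsInducedMinor minor
    C′ = C ∪ ⁅ x ⁆
    module C′ = IsSubspace (Span-isSubspace vec C′)
    C⊆C′ : C ⊆ C′
    C⊆C′ = p⊆p∪q ⁅ x ⁆
    C′∪X′⊆C∪X : C′ ∪ X′ ⊆ C ∪ X
    C′∪X′⊆C∪X = ∪-lub (∪-lub (p⊆p∪q X) (q⊆p∪q C X ∘ x∈p⇒⁅x⁆⊆p x∈X)) (q⊆p∪q C X ∘ X′⊆X)
    representative : ∀ z → z ∈ X → ¬ InSpan M C′ (vec z) →
                     ∃ λ z′ → z′ ∈ X′ × InSpan M C′ (vec z ⊕ vec z′)
    representative z z∈X z∉C′ with z ≟ᶠ x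
    ... | yes refl = contradiction (Span-gen vec z (q⊆p∪q C ⁅ z ⁆ (x∈⁅x⁆ z))) z∉C′
    ... | no z≢x   = represented z z∈X z≢x z∉C′
    closed′ : ∀ y → InSpan M (C′ ∪ X′) (vec y) →
              InSpan M C′ (vec y) ⊎ ∃ λ z → z ∈ X′ × InSpan M C′ (vec y ⊕ vec z)
    closed′ y y∈C′∪X′ with C′.dec (vec y)
    ... | yes y∈C′ = inj₁ y∈C′
    ... | no y∉C′ with closed y (Span-mono vec C′∪X′⊆C∪X y∈C′∪X′)
    ...   | inj₁ y∈C = contradiction (Span-mono vec C⊆C′ y∈C) y∉C′
    ...   | inj₂ (z , z∈X , y≈z) =
      inj₂ (Product.map₂ (Product.map₂ (C′.≈-trans y≈′z)) (representative z z∈X z∉C′))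
      where
      y≈′z = Span-mono vec C⊆C′ y≈z
      z∉C′ = λ z∈C′ → y∉C′ (C′.∈-resp-≈ z∈C′ (C′.≈-sym y≈′z))

  Reachable⇒isInducedMinor : ∀ {C X} → Reachable M (C , X) → IsInducedMinor C X
  Reachable⇒isInducedMinor start        = ⊤-isInducedMinor
  Reachable⇒isInducedMinor (step r s) = Step-isInducedMinor (Reachable⇒isInducedMinor r) s

  dependent⇒3≤n : ∀ {C X n} (f : Fin n → Fin m) → IsInducedMinor C X → Injective _≡_ _≡_ f →
    (∀ j → f j ∈ X) → 1 ≤ n → InSpan M C (σ f ⊤) → 3 ≤ n
  dependent⇒3≤n {n = 1} f minor _ f∈X _ σ⊤∈C =
    contradiction (subst (InSpan M _) (⊕-identityʳ _) σ⊤∈C) (IsInducedMinor.nonLoop minor (f zero) (f∈X zero))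
  dependent⇒3≤n {n = 2} f minor f-injective f∈X _ σ⊤∈C =
    contradiction (subst (InSpan M _) (cong (vec (f zero) ⊕_) (⊕-identityʳ _)) σ⊤∈C)
      (IsInducedMinor.nonParallel minor (f zero) (f (suc zero)) (f∈X zero) (f∈X (suc zero))
        (0≢1+n ∘ f-injective))
  dependent⇒3≤n {n = suc (suc (suc _))} _ _ _ _ _ _ = s≤s (s≤s (s≤s z≤n))

  isoUniform⇒InducedCircuit : ∀ {C X n} → IsInducedMinor C X → 1 ≤ n →
    (iso : IsoUniform M (n ∸ 1) n C X) → InducedCircuit (InSpan M C) n (proj₁ iso)
  isoUniform⇒InducedCircuit {C} {X} {n} minor 1≤n (f , _ , f∈X , X⊆f , indep⇔) = record
    { minimal   = minimal
    ; dependent = dependent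
    ; closed    = closed′
    }
    where
    module C∪X = IsSubspace (Span-isSubspace vec (C ∪ X))
    minimal : ∀ T → InSpan M C (σ f T) → T ≡ ∅ ⊎ T ≡ ⊤
    minimal T σT∈C with T ≟ˢ ⊤
    ... | yes T≡⊤ = inj₂ T≡⊤
    ... | no T≢⊤  = inj₁ (Equivalence.to (indep⇔ T) (p≢⊤⇒∣p∣≤n∸1 T≢⊤) T id σT∈C)
    -- IsoUniform only says that ⊤ is not independent; a dependent subset is found by search.
    dependent : InSpan M C (σ f ⊤)
    dependent with anySubset? (λ T → Span? vec C (σ f T) ×-dec ¬? (T ≟ˢ ∅))
    ... | no ∄T = contradiction (Equivalence.from (indep⇔ ⊤) ⊤-indep) (∣⊤∣≰n∸1 1≤n)
      where
      ⊤-indep : IndepMod M C (vec ∘ f) ⊤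
      ⊤-indep T _ σT∈C = decidable-stable (T ≟ˢ ∅) λ T≢∅ → ∄T (T , σT∈C , T≢∅)
    ... | yes (T , σT∈C , T≢∅) with minimal T σT∈C
    ...   | inj₁ T≡∅  = contradiction T≡∅ T≢∅
    ...   | inj₂ refl = σT∈C
    closed′ : ∀ y → SpanMod (InSpan M C) f (vec y) →
              InSpan M C (vec y) ⊎ ∃ λ j → InSpan M C (vec y ⊕ vec (f j))
    closed′ y (T , y≈σT) with IsInducedMinor.closed minor y y∈C∪X
      where
      σT∈C∪X = C∪X.sum-closed (vec ∘ f) T λ j → Span-gen vec (f j) (q⊆p∪q C X (f∈X j))
      y∈C∪X  = C∪X.∈-resp-≈ σT∈C∪X (C∪X.≈-sym (Span-mono vec (p⊆p∪q X) y≈σT))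
    ... | inj₁ y∈C = inj₁ y∈C
    ... | inj₂ (z , z∈X , y≈z) with X⊆f z z∈X
    ...   | j , refl = inj₂ (j , y≈z)

  InducedCircuit₀-injective : ∀ {k f} → InducedCircuit (_≡ zeroV) (3 + k) f → Injective _≡_ _≡_ f
  InducedCircuit₀-injective {f = f} c {i} {j} fi≡fj
    with InducedCircuit.minimal c (⁅ i ⁆ ⊕ ⁅ j ⁆) σ≡0
    where
    open ≡-Reasoning
    σ≡0 : σ f (⁅ i ⁆ ⊕ ⁅ j ⁆) ≡ zeroV
    σ≡0 = begin
      σ f (⁅ i ⁆ ⊕ ⁅ j ⁆)    ≡⟨ σ-⊕⁅⁆ f ⁅ i ⁆ j ⟩
      σ f ⁅ i ⁆ ⊕ vec (f j)  ≡⟨ cong (_⊕ vec (f j)) (sumSub-⁅⁆ (vec ∘ f) i) ⟩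
      vec (f i) ⊕ vec (f j)  ≡⟨ cong (λ x → vec x ⊕ vec (f j)) fi≡fj ⟩
      vec (f j) ⊕ vec (f j)  ≡⟨ ⊕-self _ ⟩
      zeroV                  ∎
  ... | inj₁ i⊕j≡∅ = ⁅⁆-injective (⊕≡zero⇒≡ ⁅ i ⁆ ⁅ j ⁆ i⊕j≡∅)
  ... | inj₂ i⊕j≡⊤ = ⊥-elim (⊤⊈⁅x⁆∪⁅y⁆ i j ⊤⊆i∪j)
    where
    ⊤⊆i∪j = subst (_⊆ ⁅ i ⁆ ∪ ⁅ j ⁆) i⊕j≡⊤ (⊕-⊆ (p⊆p∪q ⁅ j ⁆) (q⊆p∪q ⁅ i ⁆ ⁅ j ⁆))

  InSpan-image : ∀ {n} (f : Fin n → Fin m) {v} → InSpan M (∅ ∪ image f) v → Span (vec ∘ f) ⊤ v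
  InSpan-image f (T , T⊆ , refl) =
    sumSub-closed (Span (vec ∘ f) ⊤) (Span-zero _) (Span-⊕ _) vec T λ _ → generator ∘ T⊆
    where
    generator : ∀ {x} → x ∈ ∅ ∪ image f → Span (vec ∘ f) ⊤ (vec x)
    generator {x} x∈ with x∈p∪q⁻ ∅ (image f) x∈
    ... | inj₁ x∈∅ = contradiction x∈∅ ∉⊥
    ... | inj₂ x∈f with ∈-image⁻ f x x∈f
    ...   | j , refl = Span-gen (vec ∘ f) j ∈⊤

  InducedCircuit₀-flat : ∀ {n f} → InducedCircuit (_≡ zeroV) n f → IsFlat M ∅ ⊤ (image f)
  InducedCircuit₀-flat {f = f} c = ⊆⊤ , λ x _ x∈span →
    case InducedCircuit.closed c x (spanMod (InSpan-image f x∈span)) of λ where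
      (inj₁ x≡0)        → contradiction x≡0 (noLoops x)
      (inj₂ (j , x≈fj)) → subst (_∈ image f) (sym (noParallel (⊕≡zero⇒≡ _ _ x≈fj))) (∈-image⁺ f j)
    where
    spanMod : ∀ {v} → Span (vec ∘ f) ⊤ v → SpanMod (_≡ zeroV) f v
    spanMod (T , _ , refl) = T , ⊕-self _

  InducedCircuit⇒restriction : ∀ {n f} → 3 ≤ n → InducedCircuit (_≡ zeroV) n f →
    HasCircuitInducedRestriction M n
  InducedCircuit⇒restriction {n} {f} (s≤s (s≤s (s≤s _))) c =
    image f , InducedCircuit₀-flat c , f , InducedCircuit₀-injective c , ∈-image⁺ f , ∈-image⁻ f ,
    λ S → mk⇔ (≤⇒indep S) (indep⇒≤ S)
    where
    open InducedCircuit c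
    ≤⇒indep : ∀ S → ∣ S ∣ ≤ n ∸ 1 → IndepMod M ∅ (vec ∘ f) S
    ≤⇒indep S ∣S∣≤n∸1 T T⊆S σT∈∅ with minimal T (proj₁ (Span-∅ vec) σT∈∅)
    ... | inj₁ T≡∅  = T≡∅
    ... | inj₂ refl =
      contradiction (subst (λ S → ∣ S ∣ ≤ n ∸ 1) (⊆-antisym ⊆⊤ T⊆S) ∣S∣≤n∸1) (∣⊤∣≰n∸1 (s≤s z≤n))
    indep⇒≤ : ∀ S → IndepMod M ∅ (vec ∘ f) S → ∣ S ∣ ≤ n ∸ 1
    indep⇒≤ S S-indep with S ≟ˢ ⊤
    ... | no S≢⊤   = p≢⊤⇒∣p∣≤n∸1 S≢⊤
    ... | yes refl = case S-indep ⊤ id (proj₂ (Span-∅ vec) dependent) of λ ()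

  restriction⇒minor : ∀ {n} → 1 ≤ n → HasCircuitInducedRestriction M n → HasCircuitInducedMinor M n
  restriction⇒minor 1≤n (F , F-flat , iso) = 1≤n , (∅ , F) , step start (restrict F-flat) , iso

lemma2p1 : (M : SimpleBinaryMatroid) (n : ℕ) →
    HasCircuitInducedMinor M n →
    (∀ k → HasCircuitInducedMinor M k → k ≤ n) →
    HasCircuitInducedRestriction M n
lemma2p1 M n (1≤n , (C , X) , reachable , iso@(f , f-injective , f∈X , _)) maximal =
  by-maximality (uncontractAll M id C circuit)
  where
  minor : IsInducedMinor M C X
  minor = Reachable⇒isInducedMinor M reachable
  circuit : InducedCircuit M (InSpan M C) n f
  circuit = isoUniform⇒InducedCircuit M minor 1≤n iso
  3≤n : 3 ≤ n
  3≤n = dependent⇒3≤n M f minor f-injective f∈X 1≤n (InducedCircuit.dependent circuit)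
  by-maximality : InducedCircuit≥ M (_≡ zeroV) n → HasCircuitInducedRestriction M n
  by-maximality (n′ , n≤n′ , _ , circuit′) = subst (HasCircuitInducedRestriction M) n′≡n restriction
    where
    restriction = InducedCircuit⇒restriction M (≤-trans 3≤n n≤n′) circuit′
    n′≡n = ≤-antisym (maximal n′ (restriction⇒minor M (≤-trans 1≤n n≤n′) restriction)) n≤n′
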